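{- Let $G=(V,E)$ be a finite graph and let $k,m$ be positive integers such that $km$ divides $|V|$. Suppose that every graph obtained from $G$ by adding to it (the edges of) a union of pairwise vertex-disjoint cliques on $k$ vertices each (with vertices in $V$) has choice number $k$. Then every graph obtained from $G$ by adding to it a union of pairwise vertex-disjoint cliques on $km$ vertices each (with vertices in $V$) has choice number $km$.
   Context: The choice number $ch(H)$ of a graph $H$ is the minimum $n$ such that for every assignment of sets $S(v)$ with $|S(v)|=n$ to the vertices there is a proper vertex coloring assigning each $v$ a color from $S(v)$. -}

module Defs where

open import Level using (0ℓ)
open import Data.Nat using (ℕ; _≤_)
open import Data.Fin using (Fin)
open import Data.Product using (Σ; _×_; _,_; proj₁)
open import Data.Sum using (_⊎_)
open import Data.List using (List; length)
open import Data.List.Membership.Propositional using (_∈_)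
open import Data.List.Relation.Unary.Unique.Propositional using (Unique)
open import Relation.Binary.PropositionalEquality using (_≡_; _≢_)
open import Relation.Nullary using (¬_)
open import Function.Bundles using (_↔_; Inverse)

record Graph (n : ℕ) : Set₁ where
  field
    Adj     : Fin n → Fin n → Set
    sym     : ∀ {u v} → Adj u v → Adj v u
    irrefl  : ∀ {v} → ¬ Adj v v
open Graph public

-- A partition of Fin n into (some number q of) blocks of exactly s vertices each,
-- given as a bijection Fin n ↔ Fin q × Fin s; the block of v is proj₁ of its image.
Partition : ℕ → ℕ → Set
Partition n s = Σ ℕ λ q → Fin n ↔ (Fin q × Fin s)

block : ∀ {n s} → Partition n s → Fin n → Σ ℕ Fin
block (q , σ) v = q , proj₁ (Inverse.to σ v)

addCliques : ∀ {n s} → Graph n → Partition n s → (Fin n → Fin n → Set)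
addCliques G P u v = Adj G u v ⊎ (u ≢ v × block P u ≡ block P v)

IsListAssignment : ∀ {n} → ℕ → (Fin n → List ℕ) → Set
IsListAssignment k L = ∀ v → Unique (L v) × length (L v) ≡ k

IsProperLColouring : ∀ {n} → (Fin n → Fin n → Set) → (Fin n → List ℕ) → (Fin n → ℕ) → Set
IsProperLColouring A L c = (∀ v → c v ∈ L v) × (∀ u v → A u v → c u ≢ c v)

Choosable : ∀ {n} → (Fin n → Fin n → Set) → ℕ → Set
Choosable A k = ∀ L → IsListAssignment k L → Σ (_ → ℕ) λ c → IsProperLColouring A L c

ChoiceNumberIs : ∀ {n} → (Fin n → Fin n → Set) → ℕ → Set
ChoiceNumberIs A k = Choosable A k × (∀ j → Choosable A j → k ≤ j)

module Submission where

-- Lower bound: each block of k·m vertices is a clique, so with fewer than k·m colours two of its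
-- vertices collide (pigeonhole); if there are no blocks the graph has no vertices, and then the
-- hypothesis itself fails.
-- Upper bound: given lists of k·m colours, the grouping lemma splits each block into m groups of
-- k vertices and sorts the colours into m classes, so that every vertex of group j has at least
-- k colours of class j. It is proved greedily: group 0 is cut off at the least threshold s + 1
-- below which k vertices have k colours each; every other vertex loses at most k colours.
-- The groups form a finer partition into k-blocks. By hypothesis the graph with these k-cliques
-- can be coloured from the lists cut down to k colours of each vertex's class, and two vertices
-- of one block but different groups then get colours of different classes.

open import Defs hiding (sym)

open import Level using (0ℓ)
open import Data.Empty using (⊥; ⊥-elim)
open import Data.Nat using (ℕ; zero; suc; _+_; _*_; _≤_; _<_; z≤n; s≤s; _<?_; _≤?_; _≟_)
open import Data.Nat.Properties
  using ( ≤-reflexive; ≤-trans; <⇒≤; ≰⇒>; <⇒≱; m≤m+n; m≤n+m; m≤n⇒m≤1+n; m<n⇒m<1+n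
        ; m<1+n⇒m<n∨m≡n; m≤n⇒m⊓n≡m; +-monoˡ-≤; +-cancelˡ-≡; +-cancelˡ-≤; *-comm
        ; module ≤-Reasoning )
open import Data.Nat.Divisibility using (_∣_)
open import Data.Nat.ListAction using (sum)
open import Data.Fin using (Fin; zero; suc; toℕ; fromℕ<; combine; remQuot)
open import Data.Fin.Properties
  using (¬Fin0; toℕ-injective; fromℕ<-injective; combine-remQuot; remQuot-combine; pigeonhole)
import Data.Fin.Properties as FinProperties
open import Data.List using (List; []; _∷_; length; _++_; filter; take; drop; map; lookup; allFin; upTo)
open import Data.List.Properties
  using ( length-++; length-take; length-upTo; length-tabulate; length-filter; filter-++
        ; filter-none; filter-all; partition-defn; ++-assoc; take++drop≡id )
open import Data.List.Membership.Propositional using (_∈_)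
open import Data.List.Membership.Propositional.Properties
  using (∈-filter⁻; ∈-map⁺; ∈-++⁺ˡ; ∈-++⁺ʳ; ∈-++⁻; ∈-lookup; ∈-allFin; ∈-upTo⁻)
open import Data.List.Relation.Unary.Any using (here; there; index)
open import Data.List.Relation.Unary.Any.Properties using (lookup-index)
open import Data.List.Relation.Unary.All as All using (All; []; _∷_)
import Data.List.Relation.Unary.All.Properties as All
open import Data.List.Relation.Unary.All.Properties using (all-filter)
open import Data.List.Relation.Unary.AllPairs using ([]; _∷_)
open import Data.List.Relation.Unary.Unique.Propositional using (Unique)
import Data.List.Relation.Unary.Unique.Propositional.Properties as Unique
open import Data.List.Relation.Binary.Permutation.Propositional
  using (_↭_; ↭ₛ⇒↭; ↭⇒↭ₛ; ↭-trans; ↭-reflexive; ↭-sym)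
open import Data.List.Relation.Binary.Permutation.Propositional.Properties
  using (↭-length; ++⁺ˡ; filter-↭; ∈-resp-↭)
import Data.List.Relation.Binary.Permutation.Setoid as PermutationSetoid
import Data.List.Relation.Binary.Permutation.Setoid.Properties as PermutationSetoidProperties
open import Data.Product using (Σ; ∃; ∃₂; _×_; _,_; proj₁; proj₂; uncurry)
import Data.Product as Product
open import Data.Sum using (_⊎_; inj₁; inj₂)
open import Function using (_∘_; id)
open import Function.Bundles using (_↔_; Inverse; mk↔ₛ′)
open import Function.Properties.Inverse using (↔-trans)
open import Relation.Nullary using (¬_; Dec; yes; no; contradiction)
open import Relation.Unary using (Pred; Decidable; ∁)
open import Relation.Unary.Properties using (∁?)
open import Relation.Binary.PropositionalEquality
  using (_≡_; _≢_; refl; sym; trans; cong; cong₂; subst; setoid; module ≡-Reasoning)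

module _ {A : Set} where

  private
    module PermS = PermutationSetoid (setoid A)
    module PermP = PermutationSetoidProperties (setoid A)

  count : {P : Pred A 0ℓ} → Decidable P → List A → ℕ
  count P? xs = length (filter P? xs)

  count-mono : {P Q : Pred A 0ℓ} (P? : Decidable P) (Q? : Decidable Q) {xs : List A} →
               (∀ {x} → x ∈ xs → P x → Q x) → count P? xs ≤ count Q? xs
  count-mono P? Q? {[]}     P⇒Q = z≤n
  count-mono P? Q? {x ∷ xs} P⇒Q with P? x | Q? x | count-mono P? Q? {xs} (P⇒Q ∘ there)
  ... | yes _  | yes _ | ih = s≤s ih
  ... | yes Px | no ¬Qx | _ = contradiction (P⇒Q (here refl) Px) ¬Qx
  ... | no _   | yes _ | ih = m≤n⇒m≤1+n ih
  ... | no _   | no _  | ih = ih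

  count-filter : {P Q R : Pred A 0ℓ} (P? : Decidable P) (Q? : Decidable Q) (R? : Decidable R) →
                 (∀ {x} → Q x → P x → R x) → ∀ xs → count P? (filter Q? xs) ≤ count R? xs
  count-filter P? Q? R? QP⇒R []       = z≤n
  count-filter P? Q? R? QP⇒R (x ∷ xs) with Q? x
  ... | no _ with R? x
  ...   | yes _ = m≤n⇒m≤1+n (count-filter P? Q? R? QP⇒R xs)
  ...   | no _  = count-filter P? Q? R? QP⇒R xs
  count-filter P? Q? R? QP⇒R (x ∷ xs) | yes Qx with P? x | R? x
  ...   | yes Px | no ¬Rx = contradiction (QP⇒R Qx Px) ¬Rx
  ...   | yes _  | yes _  = s≤s (count-filter P? Q? R? QP⇒R xs)
  ...   | no _   | yes _  = m≤n⇒m≤1+n (count-filter P? Q? R? QP⇒R xs)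
  ...   | no _   | no _   = count-filter P? Q? R? QP⇒R xs

  count-insert : {P Q : Pred A 0ℓ} (P? : Decidable P) (Q? : Decidable Q) {y : A} {xs : List A} →
                 Unique xs → (∀ {x} → x ∈ xs → Q x → P x ⊎ x ≡ y) → count Q? xs ≤ suc (count P? xs)
  count-insert         P? Q? {xs = []}     []          _      = z≤n
  count-insert {P} {Q} P? Q? {xs = x ∷ xs} (x∉xs ∷ u) Q⇒P∨y
    with Q? x | P? x | count-insert P? Q? u (Q⇒P∨y ∘ there)
  ... | yes _  | yes _  | ih = s≤s ih
  ... | no _   | yes _  | ih = m≤n⇒m≤1+n ih
  ... | no _   | no _   | ih = ih
  ... | yes Qx | no ¬Px | _  = s≤s (count-mono Q? P? Q⇒P)
    where
    Q⇒P : ∀ {z} → z ∈ xs → Q z → P z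
    Q⇒P {z} z∈xs Qz with Q⇒P∨y (here refl) Qx | Q⇒P∨y (there z∈xs) Qz
    ... | inj₁ Px | _          = contradiction Px ¬Px
    ... | inj₂ _   | inj₁ Pz   = Pz
    ... | inj₂ x≡y | inj₂ z≡y = contradiction (trans x≡y (sym z≡y)) (All.lookup x∉xs z∈xs)

  ↭-partition : {P : Pred A 0ℓ} (P? : Decidable P) (xs : List A) →
                xs ↭ filter P? xs ++ filter (∁? P?) xs
  ↭-partition P? xs = ↭ₛ⇒↭ (subst (PermS._↭_ xs) (cong (uncurry _++_) (partition-defn P? xs))
                                (PermP.partition-↭ P? xs))

  count-complement : {P : Pred A 0ℓ} (P? : Decidable P) (xs : List A) →
                     count P? xs + count (∁? P?) xs ≡ length xs
  count-complement P? xs = sym (trans (↭-length (↭-partition P? xs)) (length-++ (filter P? xs)))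

  unique-↭ : {xs ys : List A} → xs ↭ ys → Unique xs → Unique ys
  unique-↭ p = PermP.Unique-resp-↭ (↭⇒↭ₛ p)

  unique-++⁻ : (xs : List A) {ys : List A} → Unique (xs ++ ys) → Unique xs × Unique ys
  unique-++⁻ []       u          = [] , u
  unique-++⁻ (x ∷ xs) (x∉ ∷ u) = Product.map₁ (All.++⁻ˡ xs x∉ ∷_) (unique-++⁻ xs u)

  unique-++-disjoint : (xs : List A) {ys : List A} {y : A} → Unique (xs ++ ys) → y ∈ xs → y ∈ ys → ⊥
  unique-++-disjoint (x ∷ xs) (x∉ ∷ _) (here refl) y∈ys = All.lookup x∉ (∈-++⁺ʳ xs y∈ys) refl
  unique-++-disjoint (x ∷ xs) (_ ∷ u)  (there y∈xs) y∈ys = unique-++-disjoint xs u y∈xs y∈ys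

  entry : (xs : List A) {k : ℕ} → length xs ≡ k → Fin k → A
  entry xs refl = lookup xs

  entry-∈ : (xs : List A) {k : ℕ} (e : length xs ≡ k) (i : Fin k) → entry xs e i ∈ xs
  entry-∈ xs refl i = ∈-lookup i

  entry-onto : (xs : List A) {k : ℕ} (e : length xs ≡ k) {x : A} → x ∈ xs → ∃ λ i → entry xs e i ≡ x
  entry-onto xs refl x∈xs = index x∈xs , sym (lookup-index x∈xs)

  entry-injective : (xs : List A) {k : ℕ} (e : length xs ≡ k) → Unique xs →
                    ∀ {i j} → entry xs e i ≡ entry xs e j → i ≡ j
  entry-injective xs refl = lookup-injective
    where
    lookup-injective : ∀ {xs} → Unique xs → ∀ {i j} → lookup xs i ≡ lookup xs j → i ≡ j
    lookup-injective {_ ∷ _}  _          {zero}  {zero}  _ = refl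
    lookup-injective {_ ∷ _}  (x∉ ∷ _) {zero}  {suc j} e = ⊥-elim (All.lookup x∉ (∈-lookup j) e)
    lookup-injective {_ ∷ _}  (x∉ ∷ _) {suc i} {zero}  e = ⊥-elim (All.lookup x∉ (∈-lookup i) (sym e))
    lookup-injective {_ ∷ xs} (_ ∷ u)    {suc i} {suc j} e = cong suc (lookup-injective u e)

  private
    All-drop-++ : {P : Pred A 0ℓ} (xs : List A) {ys : List A} {n : ℕ} →
                  length xs ≤ n → All P ys → All P (drop n (xs ++ ys))
    All-drop-++ []       {n = n}     _        Pys = All.drop⁺ n Pys
    All-drop-++ (x ∷ xs) {n = suc n} (s≤s le) Pys = All-drop-++ xs le Pys

  record Split (k : ℕ) (Q P : Pred A 0ℓ) (xs : List A) : Set where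
    field
      chosen rest   : List A
      arrangement   : xs ↭ chosen ++ rest
      chosen-length : length chosen ≡ k
      chosen-Q      : All Q chosen
      rest-¬P       : All (∁ P) rest

  -- For P ⊆ Q, if fewer than k entries have P but at least k have Q, one can choose k entries
  -- with Q, among them all entries with P: first those with P, then others with Q.
  split : {P Q : Pred A 0ℓ} (P? : Decidable P) (Q? : Decidable Q) → (∀ {x} → P x → Q x) →
          ∀ {k} xs → count P? xs < k → k ≤ count Q? xs → Split k Q P xs
  split {P} {Q} P? Q? P⇒Q {k} xs #P<k k≤#Q = record
    { chosen        = take k C
    ; rest          = drop k C ++ F
    ; arrangement   = ↭-trans (↭-partition P? xs)
                              (↭-trans (++⁺ˡ Ps (↭-partition Q? Ns)) (↭-reflexive regroup))
    ; chosen-length = trans (length-take k C) (m≤n⇒m⊓n≡m k≤|C|)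
    ; chosen-Q      = All.take⁺ k (All.++⁺ (All.map P⇒Q (all-filter P? xs)) (all-filter Q? Ns))
    ; rest-¬P       = All.++⁺ (All-drop-++ Ps (<⇒≤ #P<k) (All.filter⁺ Q? (all-filter (∁? P?) xs)))
                              (All.filter⁺ (∁? Q?) (all-filter (∁? P?) xs))
    }
    where
    Ps Ns C F : List A
    Ps = filter P? xs
    Ns = filter (∁? P?) xs
    C  = Ps ++ filter Q? Ns
    F  = filter (∁? Q?) Ns
    regroup : Ps ++ (filter Q? Ns ++ F) ≡ take k C ++ (drop k C ++ F)
    regroup = trans (sym (++-assoc Ps _ F))
                    (trans (cong (_++ F) (sym (take++drop≡id k C))) (++-assoc (take k C) _ F))
    k≤|C| : k ≤ length C
    k≤|C| = begin
      k                                      ≤⟨ k≤#Q ⟩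
      count Q? xs                            ≡⟨ ↭-length (filter-↭ Q? (↭-partition P? xs)) ⟩
      count Q? (Ps ++ Ns)                    ≡⟨ cong length (filter-++ Q? Ps Ns) ⟩
      length (filter Q? Ps ++ filter Q? Ns)  ≡⟨ length-++ (filter Q? Ps) ⟩
      count Q? Ps + count Q? Ns              ≤⟨ +-monoˡ-≤ _ (length-filter Q? Ps) ⟩
      length Ps + count Q? Ns                ≡⟨ sym (length-++ Ps) ⟩
      length C                               ∎
      where open ≤-Reasoning

below : ℕ → List ℕ → ℕ
below s = count (_<? s)

atLeast : ℕ → List ℕ → List ℕ
atLeast t = filter (∁? (_<? t))

below-zero : ∀ xs → below 0 xs ≡ 0
below-zero xs = cong length (filter-none (_<? 0) (All.universal (λ _ ()) xs))

below-all : ∀ {s} xs → All (_< s) xs → below s xs ≡ length xs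
below-all {s} xs c<s = cong length (filter-all (_<? s) c<s)

below-mono : ∀ s xs → below s xs ≤ below (suc s) xs
below-mono s xs = count-mono (_<? s) (_<? suc s) {xs} (λ _ → m<n⇒m<1+n)

below-step : ∀ s {xs} → Unique xs → below (suc s) xs ≤ suc (below s xs)
below-step s {xs} u = count-insert (_<? s) (_<? suc s) {s} {xs} u (λ _ → m<1+n⇒m<n∨m≡n)

switch : {P : ℕ → Set} → (∀ n → Dec (P n)) → ¬ P 0 → ∀ S → P S → ∃ λ s → ¬ P s × P (suc s)
switch P? ¬P0 zero    PS  = contradiction PS ¬P0
switch P? ¬P0 (suc S) P1+S with P? S
... | yes PS = switch P? ¬P0 S PS
... | no ¬PS = S , ¬PS , P1+S

∈⇒≤sum : ∀ {x xs} → x ∈ xs → x ≤ sum xs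
∈⇒≤sum {xs = y ∷ ys} (here refl)  = m≤m+n y (sum ys)
∈⇒≤sum {xs = y ∷ ys} (there x∈ys) = ≤-trans (∈⇒≤sum x∈ys) (m≤n+m (sum ys) y)

prependClass : ℕ → (ℕ → ℕ) → ℕ → ℕ
prependClass t κ c with c <? t
... | yes _ = 0
... | no _  = suc (κ c)

prependClass-below : ∀ {t} κ {c} → c < t → prependClass t κ c ≡ 0
prependClass-below {t} κ {c} c<t with c <? t
... | yes _  = refl
... | no c≮t = contradiction c<t c≮t

prependClass-above : ∀ {t} κ {c} → ¬ c < t → prependClass t κ c ≡ suc (κ c)
prependClass-above {t} κ {c} c≮t with c <? t
... | yes c<t = contradiction c<t c≮t
... | no _    = refl

module Groups {X : Set} (k : ℕ) where

  Rich : (X → List ℕ) → ℕ → Pred X 0ℓ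
  Rich L s x = k ≤ below s (L x)

  rich? : ∀ L s → Decidable (Rich L s)
  rich? L s x = k ≤? below s (L x)

  record Admissible (L : X → List ℕ) (m : ℕ) (V : List X) : Set where
    field
      lists-unique : ∀ x → Unique (L x)
      unique       : Unique V
      size         : length V ≡ m * k
      colours      : ∀ {x} → x ∈ V → m * k ≤ length (L x)

  record Grouping (L : X → List ℕ) (m : ℕ) (V : List X) : Set where
    field
      member           : Fin m → Fin k → X
      class            : ℕ → ℕ
      member-injective : ∀ {j i j′ i′} → member j i ≡ member j′ i′ → j ≡ j′ × i ≡ i′
      member-∈         : ∀ j i → member j i ∈ V
      member-onto      : ∀ {x} → x ∈ V → ∃₂ λ j i → member j i ≡ x
      enough-colours   : ∀ j i → k ≤ count (λ c → class c ≟ toℕ j) (L (member j i))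

  -- There is a threshold s with fewer than k items rich below s but at least k rich below
  -- s + 1: no item is rich below 0, and all are rich below a bound S on all colours.
  threshold : 1 ≤ k → ∀ {L m V} → Admissible L (suc m) V →
              ∃ λ s → count (rich? L s) V < k × k ≤ count (rich? L (suc s)) V
  threshold 1≤k {L} {m} {V} adm =
    Product.map₂ (Product.map₁ ≰⇒>) (switch enough? none-rich-below-0 S all-rich-below-S)
    where
    open Admissible adm
    enough? : ∀ s → Dec (k ≤ count (rich? L s) V)
    enough? s = k ≤? count (rich? L s) V
    none-rich-below-0 : ¬ k ≤ count (rich? L 0) V
    none-rich-below-0 =
      <⇒≱ 1≤k ∘ subst (k ≤_) (cong length (filter-none (rich? L 0) (All.universal poor V)))
      where
      poor : ∀ x → ¬ Rich L 0 x
      poor x = <⇒≱ 1≤k ∘ subst (k ≤_) (below-zero (L x))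
    S : ℕ
    S = suc (sum (map (sum ∘ L) V))
    rich-below-S : ∀ {x} → x ∈ V → Rich L S x
    rich-below-S {x} x∈V = subst (k ≤_) (sym (below-all (L x) (All.tabulate c<S)))
                                 (≤-trans (m≤m+n k (m * k)) (colours x∈V))
      where
      c<S : ∀ {c} → c ∈ L x → c < S
      c<S c∈Lx = s≤s (≤-trans (∈⇒≤sum c∈Lx) (∈⇒≤sum (∈-map⁺ (sum ∘ L) x∈V)))
    all-rich-below-S : k ≤ count (rich? L S) V
    all-rich-below-S =
      subst (k ≤_) (sym (trans (cong length (filter-all (rich? L S) (All.tabulate rich-below-S))) size))
            (m≤m+n k (m * k))

  firstGroup : 1 ≤ k → ∀ {L m V} → Admissible L (suc m) V →
               ∃ λ s → Split k (Rich L (suc s)) (Rich L s) V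
  firstGroup 1≤k {L} {V = V} adm with threshold 1≤k adm
  ... | s , few , many =
    s , split (rich? L s) (rich? L (suc s)) (λ {x} r → ≤-trans r (below-mono s (L x))) V few many

  -- The items left after the first group keep their colours above the threshold; at most k
  -- colours were lost, so (m+1)·k items with (m+1)·k colours become m·k items with m·k colours.
  restAdmissible : ∀ {L m V s} → Admissible L (suc m) V → (sp : Split k (Rich L (suc s)) (Rich L s) V) →
                   Admissible (atLeast (suc s) ∘ L) m (Split.rest sp)
  restAdmissible {L} {m} {V} {s} adm sp = record
    { lists-unique = λ x → Unique.filter⁺ (∁? (_<? suc s)) (lists-unique x)
    ; unique       = proj₂ (unique-++⁻ chosen (unique-↭ arrangement unique))
    ; size         = +-cancelˡ-≡ k _ _ (begin-equality
                       k + length rest               ≡⟨ cong (_+ length rest) (sym chosen-length) ⟩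
                       length chosen + length rest   ≡⟨ sym (length-++ chosen) ⟩
                       length (chosen ++ rest)       ≡⟨ sym (↭-length arrangement) ⟩
                       length V                      ≡⟨ size ⟩
                       k + m * k                     ∎)
    ; colours      = remaining
    }
    where
    open Admissible adm
    open Split sp
    open ≤-Reasoning
    remaining : ∀ {x} → x ∈ rest → m * k ≤ length (atLeast (suc s) (L x))
    remaining {x} x∈rest = +-cancelˡ-≤ k _ _ (begin
      k + m * k                                            ≤⟨ colours x∈V ⟩
      length (L x)                                         ≡⟨ sym (count-complement (_<? suc s) (L x)) ⟩
      below (suc s) (L x) + length (atLeast (suc s) (L x)) ≤⟨ +-monoˡ-≤ _ lost≤k ⟩
      k + length (atLeast (suc s) (L x))                   ∎)
      where
      x∈V : x ∈ V
      x∈V = ∈-resp-↭ (↭-sym arrangement) (∈-++⁺ʳ chosen x∈rest)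
      lost≤k : below (suc s) (L x) ≤ k
      lost≤k = ≤-trans (below-step s (lists-unique x)) (≰⇒> (All.lookup rest-¬P x∈rest))

  -- The chosen items form group 0 and keep the colours below s + 1 (class 0); the grouping of
  -- the rest, which only uses colours from s + 1 on, is shifted up by one group.
  extend : ∀ {L m V} s (sp : Split k (Rich L (suc s)) (Rich L s) V) → Unique V →
           Grouping (atLeast (suc s) ∘ L) m (Split.rest sp) → Grouping L (suc m) V
  extend {L} {m} {V} s sp uV rest-grouping = record
    { member           = member
    ; class            = class
    ; member-injective = injective
    ; member-∈         = member-∈
    ; member-onto      = onto
    ; enough-colours   = enough
    }
    where
    open Split sp
    module R = Grouping rest-grouping

    uV′ : Unique (chosen ++ rest)
    uV′ = unique-↭ arrangement uV

    member : Fin (suc m) → Fin k → X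
    member zero    = entry chosen chosen-length
    member (suc j) = R.member j

    class : ℕ → ℕ
    class = prependClass (suc s) R.class

    chosen∩rest : ∀ {i j′ i′} → member zero i ≢ member (suc j′) i′
    chosen∩rest {i} {j′} {i′} e = unique-++-disjoint chosen uV′ (entry-∈ chosen chosen-length i)
                                    (subst (_∈ rest) (sym e) (R.member-∈ j′ i′))

    injective : ∀ {j i j′ i′} → member j i ≡ member j′ i′ → j ≡ j′ × i ≡ i′
    injective {zero}  {_} {zero}   e =
      refl , entry-injective chosen chosen-length (proj₁ (unique-++⁻ chosen uV′)) e
    injective {zero}  {_} {suc _}  e = contradiction e chosen∩rest
    injective {suc _} {_} {zero}   e = contradiction (sym e) chosen∩rest
    injective {suc _} {_} {suc _}  e = Product.map₁ (cong suc) (R.member-injective e)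

    member-∈ : ∀ j i → member j i ∈ V
    member-∈ zero    i = ∈-resp-↭ (↭-sym arrangement) (∈-++⁺ˡ (entry-∈ chosen chosen-length i))
    member-∈ (suc j) i = ∈-resp-↭ (↭-sym arrangement) (∈-++⁺ʳ chosen (R.member-∈ j i))

    onto : ∀ {x} → x ∈ V → ∃₂ λ j i → member j i ≡ x
    onto x∈V with ∈-++⁻ chosen (∈-resp-↭ arrangement x∈V)
    ... | inj₁ x∈chosen = zero , entry-onto chosen chosen-length x∈chosen
    ... | inj₂ x∈rest   = Product.map suc id (R.member-onto x∈rest)

    enough : ∀ j i → k ≤ count (λ c → class c ≟ toℕ j) (L (member j i))
    enough zero i = ≤-trans (All.lookup chosen-Q (entry-∈ chosen chosen-length i))
                            (count-mono (_<? suc s) (λ c → class c ≟ 0) {L (member zero i)}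
                                        (λ _ → prependClass-below R.class))
    enough (suc j) i = ≤-trans (R.enough-colours j i)
                               (count-filter (λ c → R.class c ≟ toℕ j) (∁? (_<? suc s))
                                             (λ c → class c ≟ suc (toℕ j))
                                             (λ c≮1+s e → trans (prependClass-above R.class c≮1+s) (cong suc e))
                                             (L (R.member j i)))

  grouping : 1 ≤ k → ∀ m {L V} → Admissible L m V → Grouping L m V
  grouping _ zero {V = []} adm = record
    { member = λ () ; class = λ _ → 0 ; member-injective = λ {j} → ⊥-elim (¬Fin0 j)
    ; member-∈ = λ () ; member-onto = λ () ; enough-colours = λ () }
  grouping _ zero {V = _ ∷ _} adm with () ← Admissible.size adm
  grouping 1≤k (suc m) adm with firstGroup 1≤k adm
  ... | s , sp = extend s sp (Admissible.unique adm) (grouping 1≤k m (restAdmissible adm sp))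

open Groups using (Grouping; grouping)

∈-take-filter : {A : Set} {P : Pred A 0ℓ} (P? : Decidable P) (k : ℕ) {xs : List A} {x : A} →
                x ∈ take k (filter P? xs) → x ∈ xs × P x
∈-take-filter P? k = All.lookup (All.take⁺ k (All.tabulate (∈-filter⁻ P?)))

groupingBijection : ∀ {s m k} {L : Fin s → List ℕ} → Grouping k L m (allFin s) →
                    Fin s ↔ (Fin m × Fin k)
groupingBijection {s} {m} {k} g = mk↔ₛ′ label (uncurry member) label-member member-label
  where
  open Grouping g
  label : Fin s → Fin m × Fin k
  label x = proj₁ (member-onto (∈-allFin x)) , proj₁ (proj₂ (member-onto (∈-allFin x)))
  member-label : ∀ x → uncurry member (label x) ≡ x
  member-label x = proj₂ (proj₂ (member-onto (∈-allFin x)))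
  label-member : ∀ p → label (uncurry member p) ≡ p
  label-member (j , i) = uncurry (cong₂ _,_) (member-injective (member-label (member j i)))

-- Refining a partition into q blocks of size s, by splitting each block b via β b into m
-- sub-blocks of size k, gives a partition into q·m blocks of size k; sub-block j of block b
-- becomes block combine b j.
refine : ∀ {n q s m k} → Fin n ↔ (Fin q × Fin s) → (Fin q → Fin s ↔ (Fin m × Fin k)) →
         Fin n ↔ (Fin (q * m) × Fin k)
refine {q = q} {s} {m} {k} σ β = ↔-trans σ (mk↔ₛ′ subdivide merge subdivide-merge merge-subdivide)
  where
  module β (b : Fin q) = Inverse (β b)
  subdivide : Fin q × Fin s → Fin (q * m) × Fin k
  subdivide (b , x) = combine b (proj₁ (β.to b x)) , proj₂ (β.to b x)
  merge : Fin (q * m) × Fin k → Fin q × Fin s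
  merge (a , i) with remQuot {q} m a
  ... | b , j = b , β.from b (j , i)
  subdivide-merge : ∀ p → subdivide (merge p) ≡ p
  subdivide-merge (a , i) = begin
    subdivide (merge (a , i))  ≡⟨ cong (λ p → combine b (proj₁ p) , proj₂ p) (β.strictlyInverseˡ b (j , i)) ⟩
    combine b j , i            ≡⟨ cong (_, i) (combine-remQuot {q} m a) ⟩
    a , i                      ∎
    where
    open ≡-Reasoning
    b : Fin q
    b = proj₁ (remQuot {q} m a)
    j : Fin m
    j = proj₂ (remQuot {q} m a)
  merge-subdivide : ∀ p → merge (subdivide p) ≡ p
  merge-subdivide (b , x) = begin
    merge (subdivide (b , x))  ≡⟨ cong (λ p → proj₁ p , β.from (proj₁ p) (proj₂ p , proj₂ (β.to b x)))
                                       (remQuot-combine b (proj₁ (β.to b x))) ⟩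
    b , β.from b (β.to b x)    ≡⟨ cong (b ,_) (β.strictlyInverseʳ b x) ⟩
    b , x                      ∎
    where open ≡-Reasoning

sameBlock : ∀ {q} {a b : Fin q} → _≡_ {A = Σ ℕ Fin} (q , a) (q , b) → a ≡ b
sameBlock e = toℕ-injective (cong (toℕ ∘ proj₂) e)

blockClique : ∀ {n q s} (G : Graph n) (σ : Fin n ↔ (Fin q × Fin s)) (b : Fin q) {x y : Fin s} →
              x ≢ y → addCliques G (q , σ) (Inverse.from σ (b , x)) (Inverse.from σ (b , y))
blockClique {q = q} G σ b {x} {y} x≢y = inj₂ (distinct , trans (in-block x) (sym (in-block y)))
  where
  module σ = Inverse σ
  in-block : ∀ z → block (q , σ) (σ.from (b , z)) ≡ (q , b)
  in-block z = cong (λ p → q , proj₁ p) (σ.strictlyInverseˡ (b , z))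
  distinct : σ.from (b , x) ≢ σ.from (b , y)
  distinct e = x≢y (cong proj₂ (trans (sym (σ.strictlyInverseˡ (b , x)))
                                      (trans (cong σ.to e) (σ.strictlyInverseˡ (b , y)))))

-- A graph containing a clique on r vertices is not choosable with fewer than r colours: with the
-- list 0, …, j−1 everywhere and j < r, two clique vertices get the same colour (pigeonhole).
clique⇒≤ : ∀ {n r} (A : Fin n → Fin n → Set) (f : Fin r → Fin n) →
           (∀ {a b} → a ≢ b → A (f a) (f b)) → ∀ j → Choosable A j → r ≤ j
clique⇒≤ {r = r} A f clique j choosable with r ≤? j
... | yes r≤j = r≤j
... | no r≰j with choosable (λ _ → upTo j) (λ _ → Unique.upTo⁺ j , length-upTo j)
...   | c , c<j , proper with pigeonhole (≰⇒> r≰j) (λ a → fromℕ< (∈-upTo⁻ (c<j (f a))))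
...     | a , b , a<b , same-colour =
  ⊥-elim (proper (f a) (f b) (clique (FinProperties.<⇒≢ a<b)) (fromℕ<-injective _ _ _ _ same-colour))

vertexless-choosable : ∀ {n} (A : Fin n → Fin n → Set) → (Fin n → ⊥) → ∀ j → Choosable A j
vertexless-choosable A no-vertex j L _ =
  (λ _ → 0) , (λ v → ⊥-elim (no-vertex v)) , (λ u → ⊥-elim (no-vertex u))

-- The
-- grouping lemma, applied inside each block, yields a refined partition P′ into k-blocks and
-- shorter lists L′ of size k such that any L′-colouring avoiding conflicts on G and in the
-- k-blocks of P′ is an L-colouring avoiding conflicts on G and in the k·m-blocks of σ.
module Refinement {n q k m : ℕ} (1≤k : 1 ≤ k) (σ : Fin n ↔ (Fin q × Fin (k * m)))
                  (L : Fin n → List ℕ) (isL : IsListAssignment (k * m) L) where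

  private
    module σ = Inverse σ

  blockLists : Fin q → Fin (k * m) → List ℕ
  blockLists b x = L (σ.from (b , x))

  blockGrouping : (b : Fin q) → Grouping k (blockLists b) m (allFin (k * m))
  blockGrouping b = grouping k 1≤k m record
    { lists-unique = λ _ → proj₁ (isL _)
    ; unique       = Unique.allFin⁺ (k * m)
    ; size         = trans (length-tabulate id) (*-comm k m)
    ; colours      = λ {x} _ → ≤-reflexive (trans (*-comm m k) (sym (proj₂ (isL (σ.from (b , x))))))
    }

  subBlocks : (b : Fin q) → Fin (k * m) ↔ (Fin m × Fin k)
  subBlocks b = groupingBijection (blockGrouping b)

  P′ : Partition n k
  P′ = q * m , refine σ subBlocks

  blockOf : Fin n → Fin q
  blockOf v = proj₁ (σ.to v)

  groupOf : Fin n → Fin m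
  groupOf v = proj₁ (Inverse.to (subBlocks (blockOf v)) (proj₂ (σ.to v)))

  classOf : Fin n → ℕ → ℕ
  classOf v = Grouping.class (blockGrouping (blockOf v))

  keep? : ∀ v → Decidable (λ c → classOf v c ≡ toℕ (groupOf v))
  keep? v c = classOf v c ≟ toℕ (groupOf v)

  L′ : Fin n → List ℕ
  L′ v = take k (filter (keep? v) (L v))

  -- v has at least k colours of that class (its position is member j i of the grouping).
  enough-kept : ∀ v → k ≤ count (keep? v) (L v)
  enough-kept v = subst (λ w → k ≤ count (keep? v) (L w)) in-place
                        (Grouping.enough-colours (blockGrouping b) (proj₁ (β.to x)) (proj₂ (β.to x)))
    where
    b : Fin q
    b = blockOf v
    x : Fin (k * m)
    x = proj₂ (σ.to v)
    module β = Inverse (subBlocks b)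
    in-place : σ.from (b , β.from (β.to x)) ≡ v
    in-place = trans (cong (λ y → σ.from (b , y)) (β.strictlyInverseʳ x)) (σ.strictlyInverseʳ v)

  isL′ : IsListAssignment k L′
  isL′ v = Unique.take⁺ k (Unique.filter⁺ (keep? v) (proj₁ (isL v))) ,
           trans (length-take k _) (m≤n⇒m⊓n≡m (enough-kept v))

  -- In a common k·m-block, vertices of the same group share a k-block of P′, while vertices of
  -- different groups get colours of different classes.
  lift : (G : Graph n) (c : Fin n → ℕ) → IsProperLColouring (addCliques G P′) L′ c →
         IsProperLColouring (addCliques G (q , σ)) L c
  lift G c (c∈L′ , proper′) = (λ v → proj₁ (kept v)) , proper
    where
    kept : ∀ v → c v ∈ L v × classOf v (c v) ≡ toℕ (groupOf v)
    kept v = ∈-take-filter (keep? v) k (c∈L′ v)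
    proper : ∀ u v → addCliques G (q , σ) u v → c u ≢ c v
    proper u v (inj₁ edge) = proper′ u v (inj₁ edge)
    proper u v (inj₂ (u≢v , same)) with groupOf u FinProperties.≟ groupOf v
    ... | yes same-group =
      proper′ u v (inj₂ (u≢v , cong₂ (λ b j → q * m , combine b j) (sameBlock same) same-group))
    ... | no other-group = λ cu≡cv → other-group (toℕ-injective (begin
      toℕ (groupOf u)      ≡⟨ sym (proj₂ (kept u)) ⟩
      classOf u (c u)      ≡⟨ cong (classOf u) cu≡cv ⟩
      classOf u (c v)      ≡⟨ cong (λ b → Grouping.class (blockGrouping b) (c v)) (sameBlock same) ⟩
      classOf v (c v)      ≡⟨ proj₂ (kept v) ⟩
      toℕ (groupOf v)      ∎))
      where open ≡-Reasoning

-- The choice number is at least the clique size k·m, as every block is a clique. If there are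
-- no blocks there are no vertices; then the hypothesis fails, since a vertexless graph is
-- 0-choosable while its choice number would be k ≥ 1.
blockSize≤ : ∀ {n k m} (G : Graph n) → 1 ≤ k →
             ((P : Partition n k) → ChoiceNumberIs (addCliques G P) k) →
             ∀ q (σ : Fin n ↔ (Fin q × Fin (k * m))) j → Choosable (addCliques G (q , σ)) j →
             k * m ≤ j
blockSize≤ G _ _ (suc q) σ j =
  clique⇒≤ _ (λ x → Inverse.from σ (zero , x)) (blockClique G σ zero) j
blockSize≤ {n} {k} {m} G 1≤k H zero σ j _ =
  contradiction (proj₂ (H P₀) 0 (vertexless-choosable _ no-vertex 0)) (<⇒≱ 1≤k)
  where
  no-vertex : Fin n → ⊥
  no-vertex v = ¬Fin0 (proj₁ (Inverse.to σ v))
  P₀ : Partition n k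
  P₀ = 0 , refine {m = m} σ (λ ())

-- Upper bound by colouring through the refinement, lower bound by blockSize≤.
theorem7p3 : (n : ℕ) (G : Graph n) (k m : ℕ) → 1 ≤ k → 1 ≤ m → (k * m) ∣ n →
    ((P : Partition n k) → ChoiceNumberIs (addCliques G P) k) →
    (P : Partition n (k * m)) → ChoiceNumberIs (addCliques G P) (k * m)
theorem7p3 n G k m 1≤k _ _ H (q , σ) = choosable , blockSize≤ G 1≤k H q σ
  where
  choosable : Choosable (addCliques G (q , σ)) (k * m)
  choosable L isL = proj₁ colouring , lift G (proj₁ colouring) (proj₂ colouring)
    where
    open Refinement 1≤k σ L isL
    colouring : Σ (Fin n → ℕ) (IsProperLColouring (addCliques G P′) L′)
    colouring = proj₁ (H P′) L′ isL′
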